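{- Let $n\ge2$ and $m\ge3$. For $j\in\{1,\dots,m-1\}$ let $\tilde{\mathbf{w}}_j=(j,1,0,\dots,0)\in\mathbb{N}_0^n$. Then for all distinct $j,k\in\{1,\dots,m-1\}$, $(r^B,\tilde{\mathbf{w}}_j)\not\sim_m(r^B,\tilde{\mathbf{w}}_k)$; that is, each $\tilde{\mathbf{w}}_j$ identifies a different Borda equivalence class $\mathcal{E}^{r^B}_{\tilde{\mathbf{w}}_j,m}$.
   Context: Players $N=\{1,\dots,n\}$; alternatives $A=\{a_1,\dots,a_m\}$; $\mathcal{P}(A)$ is the set of strict linear orders on $A$; a profile is $\mathbf{P}=(P_1,\dots,P_n)$. For $\mathbf{w}\in\mathbb{N}_0^n\setminus\{\mathbf{0}\}$ the weighted Borda rule $r^B|\mathbf{w}(\mathbf{P})$ selects the alternative $a$ maximizing $\sum_{i\in N}w_i\,|\{a'\in A: a\,P_i\,a'\}|$, ties broken lexicographically (smallest index wins); $r^B|\mathbf{0}\equiv a_1$. Structural equivalence: $(r,\mathbf{w})\sim_m(r,\mathbf{w}')$ means there exist bijections $\pi:N\to N$ and $\tilde\pi:A\to A$ such that for every profile $\mathbf{P}$, with $\mathbf{P}'$ defined by $\tilde\pi(a_j)\,P'_{\pi(i)}\,\tilde\pi(a_k)\iff a_jP_ia_k$, one has $\tilde\pi(r|\mathbf{w}(\mathbf{P}))=r|\mathbf{w}'(\mathbf{P}')$. The class of $\bar{\mathbf{w}}$ is $\mathcal{E}^r_{\bar{\mathbf{w}},m}=\{\mathbf{w}:(r,\mathbf{w})\sim_m(r,\bar{\mathbf{w}})\}$.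 -}

module Defs where

open import Data.Nat using (ℕ; zero; suc; _+_; _*_; _≤?_)
open import Data.Fin using (Fin; zero; suc; _<_; _<?_)
open import Data.Fin.Permutation using (Permutation′; _⟨$⟩ʳ_)
open import Data.List using (List; length; filter; allFin; map)
open import Data.Nat.ListAction using (sum)
open import Data.Bool using (if_then_else_)
open import Relation.Nullary.Decidable using (does)
open import Relation.Binary.PropositionalEquality using (_≡_)
open import Function.Bundles using (_⇔_)

-- A strict linear order on the alternatives Fin m, encoded (bijectively) by a
-- rank permutation: rank a = position of a, higher position = more preferred.
LinOrder : ℕ → Set
LinOrder m = Permutation′ m

_≻[_]_ : {m : ℕ} → Fin m → LinOrder m → Fin m → Set
a ≻[ P ] b = (P ⟨$⟩ʳ b) < (P ⟨$⟩ʳ a)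

_≻?[_]_ : {m : ℕ} → (a : Fin m) → (P : LinOrder m) → (b : Fin m) → _
a ≻?[ P ] b = (P ⟨$⟩ʳ b) <? (P ⟨$⟩ʳ a)

Profile : ℕ → ℕ → Set
Profile n m = Fin n → LinOrder m

Weights : ℕ → Set
Weights n = Fin n → ℕ

bordaScore : {m : ℕ} → LinOrder m → Fin m → ℕ
bordaScore {m} P a = length (filter (λ a' → a ≻?[ P ] a') (allFin m))

weightedScore : {n m : ℕ} → Weights n → Profile n m → Fin m → ℕ
weightedScore {n} w P a = sum (map (λ i → w i * bordaScore (P i) a) (allFin n))

-- index maximizing f, ties broken in favour of the smallest index
argmax : {k : ℕ} → (Fin (suc k) → ℕ) → Fin (suc k)
argmax {zero} f = zero
argmax {suc k} f =
  let i = suc (argmax {k} (λ x → f (suc x))) in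
  if does (f i ≤? f zero) then zero else i

-- weighted Borda rule (for at least one alternative).  When w = 0 all scores
-- are 0 and the rule returns a₁ = zero, matching r^B|0 ≡ a₁.
bordaRule : {n m : ℕ} → Weights n → Profile n (suc m) → Fin (suc m)
bordaRule w P = argmax (weightedScore w P)

StructEquiv : (n m : ℕ) → Weights n → Weights n → Set
StructEquiv n m w w' =
  Σ (Permutation′ n) λ π → Σ (Permutation′ (suc m)) λ τ →
    (P P' : Profile n (suc m)) →
    (∀ i a b → (a ≻[ P i ] b) ⇔ ((τ ⟨$⟩ʳ a) ≻[ P' (π ⟨$⟩ʳ i) ] (τ ⟨$⟩ʳ b))) →
    τ ⟨$⟩ʳ bordaRule w P ≡ bordaRule w' P'
  where open import Data.Product using (Σ)

wTilde : (n' : ℕ) → ℕ → Weights (suc (suc n'))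
wTilde n' j zero = j
wTilde n' j (suc zero) = 1
wTilde n' j (suc (suc _)) = 0

-- A structural equivalence (π, τ) from w̃_j to w̃_k transports the w̃_j-Borda winner of a
-- relabelled profile to the w̃_k-winner, so two profiles A, B must have the same w̃_k-winner
-- as soon as the voters u = π 1 and v = π 2 (weights j and 1 after pulling back) give every
-- alternative the same score j·rank_u + rank_v in A and in B.  For each position of u and v
-- we exhibit such A, B with different w̃_k-winners.  If one of u, v is voter 1, B is A with
-- a₁ and a₂ swapped: in A one of u, v ranks a₁ one place above a₂ while the other ranks a₂
-- j places above a₁, which j·rank_u + rank_v cannot see but the k-weighted score can, as
-- k ≠ j, and a₁, a₂ beat all other alternatives.  Otherwise A and B differ only in voter 1.

module Submission where

open import Defs
open import Data.Nat using (ℕ; suc; _≤_; _<_)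
open import Relation.Binary.PropositionalEquality using (_≢_)
open import Relation.Nullary using (¬_)

import Algebra.Properties.CommutativeMonoid.Sum as MonoidSum
open import Data.Bool using (if_then_else_; true; false)
open import Data.Empty using (⊥)
open import Data.Fin using (Fin; zero; suc; toℕ; fromℕ<; _<?_; _≟_)
open import Data.Fin.Permutation as Perm using (Permutation′; _⟨$⟩ʳ_; _∘ₚ_; transpose; reverse)
open import Data.Fin.Properties using (toℕ≤pred[n]; toℕ-injective; toℕ-fromℕ<; opposite-prop; 0≢1+n)
open import Data.List using (length; filter; map; tabulate)
import Data.Nat.ListAction as List
open import Data.Nat using (zero; _+_; _*_; _∸_; _≤ᵇ_; s≤s)
open import Data.Nat.Properties
  using ( +-0-commutativeMonoid; ≤-refl; ≤-trans; ≤-antisym; ≤-reflexive; ≤-pred; <⇒≤; ≰⇒>; <⇒≱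
        ; ≤∧≢⇒<; <-≤-trans; m≤n+m; m≤m+n; ≤ᵇ-reflects-≤; +-identityʳ; *-identityˡ
        ; +-mono-≤-<; *-monoʳ-≤; +-cancelˡ-≡; +-cancelʳ-≡; m+[n∸m]≡n; m*n≡1⇒m≡1; m*n≡1⇒n≡1 )
open import Data.Nat.Tactic.RingSolver using (solve-∀)
open import Data.Product using (_,_)
open import Data.Sum using (_⊎_; inj₁; inj₂; [_,_])
open import Function using (_∘_; id)
open import Function.Bundles using (Injection; Equivalence; _⇔_; mk⇔)
open import Function.Construct.Identity using (⇔-id)
open import Function.Properties.Inverse using (↔⇒↣)
open import Relation.Binary.PropositionalEquality
  using (_≡_; refl; sym; trans; cong; cong₂; subst; subst₂; module ≡-Reasoning)
open import Relation.Nullary using (Dec; does; yes; no; contradiction)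
open import Relation.Nullary.Reflects using (ofʸ; ofⁿ)
open import Relation.Unary using (Pred; Decidable)

open MonoidSum +-0-commutativeMonoid using (sum; sum-permute; sum-replicate-zero)
open ≡-Reasoning

indicator : ∀ {p} {P : Set p} → Dec P → ℕ
indicator P? = if does P? then 1 else 0

length-filter-tabulate : ∀ {a p} {A : Set a} {P : Pred A p} (P? : Decidable P) {m} (f : Fin m → A) →
  length (filter P? (tabulate f)) ≡ sum (λ i → indicator (P? (f i)))
length-filter-tabulate P? {zero}  f = refl
length-filter-tabulate P? {suc m} f with does (P? (f zero))
... | true  = cong suc (length-filter-tabulate P? (f ∘ suc))
... | false = length-filter-tabulate P? (f ∘ suc)

sum-indicator-< : ∀ {m} (c : Fin m) → sum {m} (λ i → indicator (i <? c)) ≡ toℕ c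
sum-indicator-< {suc m} zero    = sum-replicate-zero (suc m)
sum-indicator-< {suc m} (suc c) = cong suc (sum-indicator-< c)

sum-map-tabulate-zero : ∀ {k} {A : Set} (g : A → ℕ) (f : Fin k → A) →
  (∀ i → g (f i) ≡ 0) → List.sum (map g (tabulate f)) ≡ 0
sum-map-tabulate-zero {zero}  g f g∘f≗0 = refl
sum-map-tabulate-zero {suc k} g f g∘f≗0 =
  cong₂ _+_ (g∘f≗0 zero) (sum-map-tabulate-zero g (f ∘ suc) (g∘f≗0 ∘ suc))

rank : ∀ {m} → LinOrder m → Fin m → ℕ
rank P a = toℕ (P ⟨$⟩ʳ a)

rank≤ : ∀ {m} (P : LinOrder (suc m)) a → rank P a ≤ m
rank≤ P a = toℕ≤pred[n] (P ⟨$⟩ʳ a)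

rank-injective : ∀ {m} (P : LinOrder m) {a b} → rank P a ≡ rank P b → a ≡ b
rank-injective P = Injection.injective (↔⇒↣ P) ∘ toℕ-injective

rank<-of-≢ : ∀ {m} (P : LinOrder m) x a r → rank P x ≤ r → rank P a ≡ r → x ≢ a → rank P x < r
rank<-of-≢ P x a r x≤r a≡r x≢a =
  ≤∧≢⇒< x≤r (λ x≡r → x≢a (rank-injective P (trans x≡r (sym a≡r))))

bordaScore≡rank : ∀ {m} (P : LinOrder m) a → bordaScore P a ≡ rank P a
bordaScore≡rank {m} P a = begin
  bordaScore P a                                      ≡⟨ length-filter-tabulate (λ b → a ≻?[ P ] b) id ⟩
  sum {m} (λ b → indicator ((P ⟨$⟩ʳ b) <? (P ⟨$⟩ʳ a))) ≡⟨ sum-permute (λ r → indicator (r <? (P ⟨$⟩ʳ a))) P ⟨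
  sum {m} (λ r → indicator (r <? (P ⟨$⟩ʳ a)))          ≡⟨ sum-indicator-< (P ⟨$⟩ʳ a) ⟩
  rank P a                                            ∎

ranking : ∀ {m} → Permutation′ (suc m) → LinOrder (suc m)
ranking σ = σ ∘ₚ reverse

rank-ranking : ∀ {m} (σ : Permutation′ (suc m)) a → rank (ranking σ) a ≡ m ∸ toℕ (σ ⟨$⟩ʳ a)
rank-ranking σ a = opposite-prop (σ ⟨$⟩ʳ a)

argmax-maximal : ∀ {k} (f : Fin (suc k) → ℕ) x → f x ≤ f (argmax f)
argmax-maximal {zero}  f zero = ≤-refl
argmax-maximal {suc k} f x
  with f (suc (argmax (f ∘ suc))) ≤ᵇ f zero | ≤ᵇ-reflects-≤ (f (suc (argmax (f ∘ suc)))) (f zero)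
     | argmax-maximal (f ∘ suc)
argmax-maximal {suc k} f zero    | true  | _         | _  = ≤-refl
argmax-maximal {suc k} f (suc x) | true  | ofʸ i≤0   | ih = ≤-trans (ih x) i≤0
argmax-maximal {suc k} f zero    | false | ofⁿ i≰0   | _  = <⇒≤ (≰⇒> i≰0)
argmax-maximal {suc k} f (suc x) | false | _         | ih = ih x

argmax-cong : ∀ {k} {f g : Fin (suc k) → ℕ} → (∀ x → f x ≡ g x) → argmax f ≡ argmax g
argmax-cong {zero}          f≗g = refl
argmax-cong {suc k} {g = g} f≗g
  rewrite argmax-cong (f≗g ∘ suc) | f≗g zero | f≗g (suc (argmax (g ∘ suc))) = refl

argmax-unique : ∀ {k} (f : Fin (suc k) → ℕ) c → (∀ x → x ≢ c → f x < f c) → argmax f ≡ c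
argmax-unique f c below with argmax f ≟ c
... | yes argmax≡c = argmax≡c
... | no  argmax≢c = contradiction (argmax-maximal f c) (<⇒≱ (below _ argmax≢c))

argmax-swap₀₁ : ∀ {k} (f : Fin (suc (suc (suc k))) → ℕ) →
  f zero ≢ f (suc zero) →
  (∀ x → f (suc (suc x)) < f zero ⊎ f (suc (suc x)) < f (suc zero)) →
  argmax f ≢ argmax (f ∘ (transpose zero (suc zero) ⟨$⟩ʳ_))
argmax-swap₀₁ f f₀≢f₁ below same =
  noMaximum (argmax f) (argmax-maximal f)
    (subst (λ c → ∀ x → g x ≤ g c) (sym same) (argmax-maximal g))
  where
  g : Fin _ → ℕ
  g = f ∘ (transpose zero (suc zero) ⟨$⟩ʳ_)
  noMaximum : ∀ c → (∀ x → f x ≤ f c) → (∀ x → g x ≤ g c) → ⊥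
  noMaximum zero          f≤ g≤ = f₀≢f₁ (≤-antisym (g≤ (suc zero)) (f≤ (suc zero)))
  noMaximum (suc zero)    f≤ g≤ = f₀≢f₁ (≤-antisym (f≤ zero) (g≤ zero))
  noMaximum (suc (suc x)) f≤ _  =
    [ (λ x<f₀ → <⇒≱ x<f₀ (f≤ zero)) , (λ x<f₁ → <⇒≱ x<f₁ (f≤ (suc zero))) ] (below x)

pairScore : ∀ {n m} → ℕ → Fin n → Fin n → Profile n m → Fin m → ℕ
pairScore c u v P a = c * rank (P u) a + rank (P v) a

pairScore-≡ : ∀ {n m} c (u v : Fin n) (P : Profile n m) a {x y} →
  rank (P u) a ≡ x → rank (P v) a ≡ y → pairScore c u v P a ≡ c * x + y
pairScore-≡ c u v P a = cong₂ (λ x y → c * x + y)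

weightedScore-wTilde : ∀ n' c {m} (P : Profile (suc (suc n')) m) a →
  weightedScore (wTilde n' c) P a ≡ pairScore c zero (suc zero) P a
weightedScore-wTilde n' c P a = begin
  c * bordaScore (P zero) a + (1 * bordaScore (P (suc zero)) a + others)
    ≡⟨ cong (λ t → c * bordaScore (P zero) a + (1 * bordaScore (P (suc zero)) a + t)) others≡0 ⟩
  c * bordaScore (P zero) a + (1 * bordaScore (P (suc zero)) a + 0)
    ≡⟨ cong (c * bordaScore (P zero) a +_) (trans (+-identityʳ _) (*-identityˡ _)) ⟩
  c * bordaScore (P zero) a + bordaScore (P (suc zero)) a
    ≡⟨ cong₂ (λ x y → c * x + y) (bordaScore≡rank (P zero) a) (bordaScore≡rank (P (suc zero)) a) ⟩
  pairScore c zero (suc zero) P a ∎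
  where
  score : Fin (suc (suc n')) → ℕ
  score i = wTilde n' c i * bordaScore (P i) a
  others : ℕ
  others = List.sum (map score (tabulate {n = n'} (λ i → suc (suc i))))
  others≡0 : others ≡ 0
  others≡0 = sum-map-tabulate-zero score (λ i → suc (suc i)) (λ _ → refl)

bordaRule-wTilde : ∀ n' c {m} (P : Profile (suc (suc n')) (suc m)) →
  bordaRule (wTilde n' c) P ≡ argmax (pairScore c zero (suc zero) P)
bordaRule-wTilde n' c P = argmax-cong (weightedScore-wTilde n' c P)

pullback : ∀ {n m} → Permutation′ n → Permutation′ m → Profile n m → Profile n m
pullback π τ P i = τ ∘ₚ P (π ⟨$⟩ʳ i)

StructEquiv⇒bordaRule-≡ : ∀ {n m} {w w' : Weights n} ((π , τ , _) : StructEquiv n m w w')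
  (A B : Profile n (suc m)) →
  (∀ a → weightedScore w (pullback π τ A) a ≡ weightedScore w (pullback π τ B) a) →
  bordaRule w' A ≡ bordaRule w' B
StructEquiv⇒bordaRule-≡ {w = w} {w'} (π , τ , equiv) A B sameScores = begin
  bordaRule w' A                        ≡⟨ equiv (pullback π τ A) A (λ _ _ _ → ⇔-id _) ⟨
  τ ⟨$⟩ʳ bordaRule w (pullback π τ A)   ≡⟨ cong (τ ⟨$⟩ʳ_) (argmax-cong sameScores) ⟩
  τ ⟨$⟩ʳ bordaRule w (pullback π τ B)   ≡⟨ equiv (pullback π τ B) B (λ _ _ _ → ⇔-id _) ⟩
  bordaRule w' B                        ∎

SamePairScores : ∀ {n m} → ℕ → Fin n → Fin n → Profile n m → Profile n m → Set
SamePairScores c u v A B = ∀ b → pairScore c u v A b ≡ pairScore c u v B b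

StructEquiv-wTilde⇒bordaRule-≡ : ∀ {n' m c} {w' : Weights (suc (suc n'))}
  ((π , τ , _) : StructEquiv (suc (suc n')) m (wTilde n' c) w') (A B : Profile (suc (suc n')) (suc m)) →
  SamePairScores c (π ⟨$⟩ʳ zero) (π ⟨$⟩ʳ suc zero) A B → bordaRule w' A ≡ bordaRule w' B
StructEquiv-wTilde⇒bordaRule-≡ {n'} {c = c} {w'} equiv@(π , τ , _) A B same =
  StructEquiv⇒bordaRule-≡ {w = wTilde n' c} {w'} equiv A B λ a → begin
    weightedScore (wTilde n' c) (pullback π τ A) a ≡⟨ weightedScore-wTilde n' c (pullback π τ A) a ⟩
    pairScore c (π ⟨$⟩ʳ zero) (π ⟨$⟩ʳ suc zero) A (τ ⟨$⟩ʳ a) ≡⟨ same (τ ⟨$⟩ʳ a) ⟩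
    pairScore c (π ⟨$⟩ʳ zero) (π ⟨$⟩ʳ suc zero) B (τ ⟨$⟩ʳ a) ≡⟨ weightedScore-wTilde n' c (pullback π τ B) a ⟨
    weightedScore (wTilde n' c) (pullback π τ B) a ∎

*-suc-+ : ∀ x s d → x * suc s + d ≡ x * s + (x + d)
*-suc-+ = solve-∀

*-suc-+-≡⇔ : ∀ x s d e → (x * suc s + d ≡ x * s + e) ⇔ (x + d ≡ e)
*-suc-+-≡⇔ x s d e = mk⇔
  (λ eq → +-cancelˡ-≡ (x * s) (x + d) e (trans (sym (*-suc-+ x s d)) eq))
  (λ eq → trans (*-suc-+ x s d) (cong (x * s +_) eq))

suc-*-+-< : ∀ k₀ s → suc k₀ * s + suc (suc s) < suc k₀ * suc (suc s) + suc s
suc-*-+-< k₀ s = subst (suc k₀ * s + suc (suc s) <_) (regroup k₀ s) (s≤s (m≤m+n _ (k₀ + k₀)))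
  where
  regroup : ∀ k₀ s → suc (suc k₀ * s + suc (suc s) + (k₀ + k₀)) ≡ suc k₀ * suc (suc s) + suc s
  regroup = solve-∀

*-+-mono-≤-< : ∀ k {a b c d} → a ≤ b → c < d → k * a + c < k * b + d
*-+-mono-≤-< k a≤b c<d = +-mono-≤-< (*-monoʳ-≤ k a≤b) c<d

-- j and k are passed as successors so that fromℕ< j<m, and the transpositions built from
-- it, compute on concrete alternatives.
module Separation (n' m' j₀ k₀ : ℕ) (j<m : suc j₀ < suc (suc (suc m'))) (j≢k : suc j₀ ≢ suc k₀) where

  j k top d : ℕ
  j   = suc j₀
  k   = suc k₀
  top = suc (suc m')
  d   = top ∸ j

  j+d≡top : j + d ≡ top
  j+d≡top = m+[n∸m]≡n (≤-pred j<m)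

  Voter Alt Prof : Set
  Voter = Fin (suc (suc n'))
  Alt   = Fin (suc (suc (suc m')))
  Prof  = Profile (suc (suc n')) (suc (suc (suc m')))

  record Separable (u v : Voter) : Set where
    constructor separates
    field
      {A B}           : Prof
      samePairScores  : SamePairScores j u v A B
      differentWinner : bordaRule (wTilde n' k) A ≢ bordaRule (wTilde n' k) B

  kScore : Prof → Alt → ℕ
  kScore = pairScore k zero (suc zero)

  kScore-≡ : ∀ (P : Prof) a {x y} →
    rank (P zero) a ≡ x → rank (P (suc zero)) a ≡ y → kScore P a ≡ k * x + y
  kScore-≡ = pairScore-≡ k zero (suc zero)

  kScore-< : ∀ (P : Prof) x y {a b} → rank (P zero) x ≤ a → rank (P (suc zero)) x < b →
    rank (P zero) y ≡ a → rank (P (suc zero)) y ≡ b → kScore P x < kScore P y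
  kScore-< P x y x≤a x<b y≡a y≡b =
    <-≤-trans (*-+-mono-≤-< k x≤a x<b) (≤-reflexive (sym (kScore-≡ P y y≡a y≡b)))

  swap₀₁ : Prof → Prof
  swap₀₁ A i = transpose zero (suc zero) ∘ₚ A i

  swap₀₁-separates : ∀ u v (A : Prof) →
    pairScore j u v A zero ≡ pairScore j u v A (suc zero) →
    kScore A zero ≢ kScore A (suc zero) →
    (∀ x → kScore A (suc (suc x)) < kScore A zero ⊎ kScore A (suc (suc x)) < kScore A (suc zero)) →
    Separable u v
  swap₀₁-separates u v A tie gap below = separates {A = A} {swap₀₁ A} same distinguished
    where
    same : SamePairScores j u v A (swap₀₁ A)
    same zero          = tie
    same (suc zero)    = sym tie
    same (suc (suc _)) = refl
    distinguished : bordaRule (wTilde n' k) A ≢ bordaRule (wTilde n' k) (swap₀₁ A)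
    distinguished sameRule = argmax-swap₀₁ (kScore A) gap below (begin
      argmax (kScore A)                  ≡⟨ bordaRule-wTilde n' k A ⟨
      bordaRule (wTilde n' k) A          ≡⟨ sameRule ⟩
      bordaRule (wTilde n' k) (swap₀₁ A) ≡⟨ bordaRule-wTilde n' k (swap₀₁ A) ⟩
      argmax (kScore (swap₀₁ A))         ∎)

  s₀₁ s₁ⱼ s₁₂ : Permutation′ (suc (suc (suc m')))
  s₀₁ = transpose zero (suc zero)
  s₁ⱼ = transpose (suc zero) (fromℕ< j<m)
  s₁₂ = transpose (suc zero) (suc (suc zero))

  rank-at-j : ∀ (σ : Permutation′ (suc (suc (suc m')))) a →
    σ ⟨$⟩ʳ a ≡ fromℕ< j<m → rank (ranking σ) a ≡ d
  rank-at-j σ a σa≡j = begin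
    rank (ranking σ) a          ≡⟨ rank-ranking σ a ⟩
    top ∸ toℕ (σ ⟨$⟩ʳ a)        ≡⟨ cong (λ i → top ∸ toℕ i) σa≡j ⟩
    top ∸ toℕ (fromℕ< j<m)      ≡⟨ cong (top ∸_) (toℕ-fromℕ< j<m) ⟩
    d                           ∎

  rank<top : ∀ (P : LinOrder (suc (suc (suc m')))) x a → rank P a ≡ top → x ≢ a → rank P x < top
  rank<top P x a = rank<-of-≢ P x a top (rank≤ P x)

  rank<second : ∀ (P : LinOrder (suc (suc (suc m')))) x a b →
    rank P a ≡ top → rank P b ≡ suc m' → x ≢ a → x ≢ b → rank P x < suc m'
  rank<second P x a b a-top b-second x≢a =
    rank<-of-≢ P x b (suc m') (≤-pred (rank<top P x a a-top x≢a)) b-second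

  top-exchange : ∀ x → (x * top + d ≡ x * suc m' + top) ⇔ (x + d ≡ top)
  top-exchange x = *-suc-+-≡⇔ x (suc m') d top

  *-top-+-≡⇒*j≡1 : ∀ x → x * top + suc m' ≡ x * d + top → x * j ≡ 1
  *-top-+-≡⇒*j≡1 x eq = +-cancelʳ-≡ (suc m') (x * j) 1 (+-cancelˡ-≡ (x * d) _ _ (begin
    x * d + (x * j + suc m') ≡⟨ regroup x j d (suc m') ⟩
    x * (j + d) + suc m'     ≡⟨ cong (λ t → x * t + suc m') j+d≡top ⟩
    x * top + suc m'         ≡⟨ eq ⟩
    x * d + top              ∎))
    where
    regroup : ∀ x j d s → x * d + (x * j + s) ≡ x * (j + d) + s
    regroup = solve-∀

  separable-zero-suc : ∀ v → Separable zero (suc v)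
  separable-zero-suc v = swap₀₁-separates zero (suc v) A tie gap below
    where
    A : Prof
    A zero    = ranking Perm.id
    A (suc _) = ranking (s₀₁ ∘ₚ s₁ⱼ)
    r₀₀ : rank (A zero) zero ≡ top
    r₀₀ = rank-ranking Perm.id zero
    r₀₁ : rank (A zero) (suc zero) ≡ suc m'
    r₀₁ = rank-ranking Perm.id (suc zero)
    r₁₀ : rank (A (suc v)) zero ≡ d
    r₁₀ = rank-at-j (s₀₁ ∘ₚ s₁ⱼ) zero refl
    r₁₁ : rank (A (suc v)) (suc zero) ≡ top
    r₁₁ = rank-ranking (s₀₁ ∘ₚ s₁ⱼ) (suc zero)
    tie : pairScore j zero (suc v) A zero ≡ pairScore j zero (suc v) A (suc zero)
    tie = begin
      pairScore j zero (suc v) A zero       ≡⟨ pairScore-≡ j zero (suc v) A zero r₀₀ r₁₀ ⟩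
      j * top + d                           ≡⟨ Equivalence.from (top-exchange j) j+d≡top ⟩
      j * suc m' + top                      ≡⟨ pairScore-≡ j zero (suc v) A (suc zero) r₀₁ r₁₁ ⟨
      pairScore j zero (suc v) A (suc zero) ∎
    gap : kScore A zero ≢ kScore A (suc zero)
    gap eq = j≢k (+-cancelʳ-≡ d j k (trans j+d≡top (sym (Equivalence.to (top-exchange k) (begin
      k * top + d         ≡⟨ kScore-≡ A zero r₀₀ r₁₀ ⟨
      kScore A zero       ≡⟨ eq ⟩
      kScore A (suc zero) ≡⟨ kScore-≡ A (suc zero) r₀₁ r₁₁ ⟩
      k * suc m' + top    ∎)))))
    below : ∀ x → kScore A (suc (suc x)) < kScore A zero ⊎ kScore A (suc (suc x)) < kScore A (suc zero)
    below x = inj₂ (kScore-< A (suc (suc x)) (suc zero)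
      (≤-pred (rank<top (A zero) (suc (suc x)) zero r₀₀ (λ ())))
      (rank<top (A (suc zero)) (suc (suc x)) (suc zero) r₁₁ (λ ()))
      r₀₁ r₁₁)

  separable-suc-zero : ∀ u → Separable (suc u) zero
  separable-suc-zero u = swap₀₁-separates (suc u) zero A tie gap below
    where
    A : Prof
    A zero    = ranking s₁ⱼ
    A (suc _) = ranking s₀₁
    r₀₀ : rank (A zero) zero ≡ top
    r₀₀ = rank-ranking s₁ⱼ zero
    r₀₁ : rank (A zero) (suc zero) ≡ d
    r₀₁ = rank-at-j s₁ⱼ (suc zero) refl
    r₁₀ : rank (A (suc u)) zero ≡ suc m'
    r₁₀ = rank-ranking s₀₁ zero
    r₁₁ : rank (A (suc u)) (suc zero) ≡ top
    r₁₁ = rank-ranking s₀₁ (suc zero)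
    tie : pairScore j (suc u) zero A zero ≡ pairScore j (suc u) zero A (suc zero)
    tie = begin
      pairScore j (suc u) zero A zero       ≡⟨ pairScore-≡ j (suc u) zero A zero r₁₀ r₀₀ ⟩
      j * suc m' + top                      ≡⟨ Equivalence.from (top-exchange j) j+d≡top ⟨
      j * top + d                           ≡⟨ pairScore-≡ j (suc u) zero A (suc zero) r₁₁ r₀₁ ⟨
      pairScore j (suc u) zero A (suc zero) ∎
    gap : kScore A zero ≢ kScore A (suc zero)
    gap eq = j≢k (trans (m*n≡1⇒n≡1 k j k*j≡1) (sym (m*n≡1⇒m≡1 k j k*j≡1)))
      where
      k*j≡1 : k * j ≡ 1
      k*j≡1 = *-top-+-≡⇒*j≡1 k (begin
        k * top + suc m'    ≡⟨ kScore-≡ A zero r₀₀ r₁₀ ⟨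
        kScore A zero       ≡⟨ eq ⟩
        kScore A (suc zero) ≡⟨ kScore-≡ A (suc zero) r₀₁ r₁₁ ⟩
        k * d + top         ∎)
    below : ∀ x → kScore A (suc (suc x)) < kScore A zero ⊎ kScore A (suc (suc x)) < kScore A (suc zero)
    below x = inj₁ (kScore-< A (suc (suc x)) zero
      (rank≤ (A zero) (suc (suc x)))
      (rank<second (A (suc zero)) (suc (suc x)) (suc zero) zero r₁₁ r₁₀ (λ ()) (λ ()))
      r₀₀ r₁₀)

  separable-suc-suc : ∀ u v → Separable (suc u) (suc v)
  separable-suc-suc u v =
    separates {A = A} {B} (λ _ → refl) λ sameRule → 0≢1+n (trans (sym ruleA) (trans sameRule ruleB))
    where
    A B : Prof
    A zero    = ranking s₁₂
    A (suc _) = ranking Perm.id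
    B zero    = ranking (s₀₁ ∘ₚ s₁₂)
    B (suc i) = A (suc i)
    a₀₀ : rank (A zero) zero ≡ top
    a₀₀ = rank-ranking s₁₂ zero
    a₀₁ : rank (A zero) (suc zero) ≡ m'
    a₀₁ = rank-ranking s₁₂ (suc zero)
    b₀₀ : rank (B zero) zero ≡ m'
    b₀₀ = rank-ranking (s₀₁ ∘ₚ s₁₂) zero
    b₀₁ : rank (B zero) (suc zero) ≡ top
    b₀₁ = rank-ranking (s₀₁ ∘ₚ s₁₂) (suc zero)
    r₁₀ : rank (A (suc zero)) zero ≡ top
    r₁₀ = rank-ranking Perm.id zero
    r₁₁ : rank (A (suc zero)) (suc zero) ≡ suc m'
    r₁₁ = rank-ranking Perm.id (suc zero)
    belowA : ∀ x → x ≢ zero → kScore A x < kScore A zero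
    belowA zero          0≢0 = contradiction refl 0≢0
    belowA (suc zero)    _   = kScore-< A (suc zero) zero
      (≤-trans (≤-reflexive a₀₁) (m≤n+m m' 2)) (≤-reflexive (cong suc r₁₁)) a₀₀ r₁₀
    belowA (suc (suc x)) _   = kScore-< A (suc (suc x)) zero
      (rank≤ (A zero) (suc (suc x))) (rank<top (A (suc zero)) (suc (suc x)) zero r₁₀ (λ ())) a₀₀ r₁₀
    belowB : ∀ x → x ≢ suc zero → kScore B x < kScore B (suc zero)
    belowB zero          _   =
      subst₂ _<_ (sym (kScore-≡ B zero b₀₀ r₁₀)) (sym (kScore-≡ B (suc zero) b₀₁ r₁₁)) (suc-*-+-< k₀ m')
    belowB (suc zero)    1≢1 = contradiction refl 1≢1
    belowB (suc (suc x)) _   = kScore-< B (suc (suc x)) (suc zero)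
      (rank≤ (B zero) (suc (suc x)))
      (rank<second (A (suc zero)) (suc (suc x)) zero (suc zero) r₁₀ r₁₁ (λ ()) (λ ()))
      b₀₁ r₁₁
    ruleA : bordaRule (wTilde n' k) A ≡ zero
    ruleA = trans (bordaRule-wTilde n' k A) (argmax-unique (kScore A) zero belowA)
    ruleB : bordaRule (wTilde n' k) B ≡ suc zero
    ruleB = trans (bordaRule-wTilde n' k B) (argmax-unique (kScore B) (suc zero) belowB)

  separable : ∀ u v → u ≢ v → Separable u v
  separable zero    zero    0≢0 = contradiction refl 0≢0
  separable zero    (suc v) _   = separable-zero-suc v
  separable (suc u) zero    _   = separable-suc-zero u
  separable (suc u) (suc v) _   = separable-suc-suc u v

proposition4 : (n' m' j k : ℕ) →
    1 ≤ j → j < suc (suc (suc m')) → 1 ≤ k → k < suc (suc (suc m')) → j ≢ k →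
    ¬ StructEquiv (suc (suc n')) (suc (suc m')) (wTilde n' j) (wTilde n' k)
proposition4 n' m' (suc j₀) (suc k₀) _ j<m _ _ j≢k equiv@(π , _ , _) =
  differentWinner (StructEquiv-wTilde⇒bordaRule-≡ {w' = wTilde n' (suc k₀)} equiv A B samePairScores)
  where
  open Separation n' m' j₀ k₀ j<m j≢k
  open Separable (separable (π ⟨$⟩ʳ zero) (π ⟨$⟩ʳ suc zero) (0≢1+n ∘ Injection.injective (↔⇒↣ π)))
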